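{- For each of the logics $\mathsf L\in\{\mathsf N,\mathsf{NeF},\mathsf{CoPC},\mathsf{MPC}\}$, the calculi $\mathbf{G3}_{\mathsf L}$ and $\mathbf{G3}^{\varphi}_{\mathsf L}$ are equivalent: a sequent $\Gamma\Rightarrow\varphi$ is derivable in $\mathbf{G3}_{\mathsf L}$ if and only if it is derivable in $\mathbf{G3}^{\varphi}_{\mathsf L}$.
   Context: Formulas are built from a countable set of propositional variables $p,q,\dots$ and the constant $\top$ (there is no $\bot$) using binary $\land,\lor,\to$ and unary $\neg$. A sequent is $\Gamma\Rightarrow\varphi$ with $\Gamma$ a finite multiset of formulas and $\varphi$ a single formula (the goal). The positive rules are: (ax) $\Gamma,p\Rightarrow p$ for a propositional variable $p$; ($\top$) $\Gamma\Rightarrow\top$; ($\to$r) from $\Gamma,\alpha\Rightarrow\beta$ infer $\Gamma\Rightarrow\alpha\to\beta$; ($\to$l) from $\Gamma,\alpha\to\beta\Rightarrow\alpha$ and $\Gamma,\beta\Rightarrow\varphi$ infer $\Gamma,\alpha\to\beta\Rightarrow\varphi$; ($\land$r) from $\Gamma\Rightarrow\alpha$ and $\Gamma\Rightarrow\beta$ infer $\Gamma\Rightarrow\alpha\land\beta$; ($\land$l) from $\Gamma,\alpha,\beta\Rightarrow\varphi$ infer $\Gamma,\alpha\land\beta\Rightarrow\varphi$; ($\lor$r$_1$), ($\lor$r$_2$) from $\Gamma\Rightarrow\alpha$ (resp. $\Gamma\Rightarrow\beta$) infer $\Gamma\Rightarrow\alpha\lor\beta$; ($\lor$l) from $\Gamma,\alpha\Rightarrow\varphi$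 and $\Gamma,\beta\Rightarrow\varphi$ infer $\Gamma,\alpha\lor\beta\Rightarrow\varphi$. The negation rules are: (n) from $\Gamma,\neg\alpha,\beta\Rightarrow\alpha$ and $\Gamma,\neg\alpha,\alpha\Rightarrow\beta$ infer $\Gamma,\neg\alpha\Rightarrow\neg\beta$; (nef) from $\Gamma,\neg\alpha\Rightarrow\alpha$ infer $\Gamma,\neg\alpha\Rightarrow\neg\beta$; (copc) from $\Gamma,\neg\alpha,\beta\Rightarrow\alpha$ infer $\Gamma,\neg\alpha\Rightarrow\neg\beta$; (an) from $\Gamma,\alpha\Rightarrow\neg\alpha$ infer $\Gamma\Rightarrow\neg\alpha$. The calculi $\mathbf{G3}_{\mathsf N}$, $\mathbf{G3}_{\mathsf{NeF}}$, $\mathbf{G3}_{\mathsf{CoPC}}$, $\mathbf{G3}_{\mathsf{MPC}}$ (without structural rules) consist of the positive rules plus, respectively, (n); (n) and (nef); (copc); (copc) and (an). For each of them, $\mathbf{G3}^{\varphi}_{\mathsf L}$ denotes the calculus obtained from $\mathbf{G3}_{\mathsf L}$ by restricting the left rules ($\to$l), ($\land$l), ($\lor$l) to instances whose goal $\varphi$ is an atom, a negation, or a disjunction. -}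

module Defs where

open import Data.Nat using (ℕ)
open import Data.List using (List; _∷_; [])
open import Data.Bool using (Bool; true; false)
open import Data.Unit using (⊤; tt)
open import Data.Empty using (⊥)
open import Data.List.Relation.Binary.Permutation.Propositional using (_↭_)

data Fm : Set where
  var  : ℕ → Fm
  top  : Fm
  _∧'_ : Fm → Fm → Fm
  _∨'_ : Fm → Fm → Fm
  _⇒_  : Fm → Fm → Fm
  ¬'_  : Fm → Fm

-- Contexts are finite multisets, represented by lists; every rule's conclusion
-- context Δ is allowed to be any permutation of the displayed context (Δ ↭ …),
-- so lists are treated exactly as multisets (no separate structural rule).
Ctx : Set
Ctx = List Fm

data Logic : Set where
  N NeF CoPC MPC : Logic

hasN : Logic → Set
hasN N    = ⊤
hasN NeF  = ⊤
hasN CoPC = ⊥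
hasN MPC  = ⊥

hasNeF : Logic → Set
hasNeF NeF = ⊤
hasNeF _   = ⊥

hasCoPC : Logic → Set
hasCoPC CoPC = ⊤
hasCoPC MPC  = ⊤
hasCoPC _    = ⊥

hasAn : Logic → Set
hasAn MPC = ⊤
hasAn _   = ⊥

-- Goal restriction for G3^φ: goal is an atom, a negation, or a disjunction.
-- (⊤ counts as a constant, not an atom/propositional variable.)
data AtNegDisj : Fm → Set where
  at   : ∀ n → AtNegDisj (var n)
  neg  : ∀ α → AtNegDisj (¬' α)
  disj : ∀ α β → AtNegDisj (α ∨' β)

-- Side condition on the goal of left rules ((→l),(∧l),(∨l)):
-- none for G3_L (restricted = false), AtNegDisj for G3^φ_L (restricted = true).
LeftOK : Bool → Fm → Set
LeftOK false φ = ⊤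
LeftOK true  φ = AtNegDisj φ

data Der (L : Logic) (r : Bool) : Ctx → Fm → Set where
  ax   : ∀ {Δ Γ} p → Δ ↭ (var p ∷ Γ) → Der L r Δ (var p)
  topR : ∀ {Γ} → Der L r Γ top
  impR : ∀ {Γ α β} → Der L r (α ∷ Γ) β → Der L r Γ (α ⇒ β)
  impL : ∀ {Δ Γ α β φ} → Δ ↭ ((α ⇒ β) ∷ Γ) → LeftOK r φ →
         Der L r ((α ⇒ β) ∷ Γ) α → Der L r (β ∷ Γ) φ → Der L r Δ φ
  andR : ∀ {Γ α β} → Der L r Γ α → Der L r Γ β → Der L r Γ (α ∧' β)
  andL : ∀ {Δ Γ α β φ} → Δ ↭ ((α ∧' β) ∷ Γ) → LeftOK r φ →
         Der L r (α ∷ β ∷ Γ) φ → Der L r Δ φ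
  orR₁ : ∀ {Γ α β} → Der L r Γ α → Der L r Γ (α ∨' β)
  orR₂ : ∀ {Γ α β} → Der L r Γ β → Der L r Γ (α ∨' β)
  orL  : ∀ {Δ Γ α β φ} → Δ ↭ ((α ∨' β) ∷ Γ) → LeftOK r φ →
         Der L r (α ∷ Γ) φ → Der L r (β ∷ Γ) φ → Der L r Δ φ
  nR   : ∀ {Δ Γ α β} → hasN L → Δ ↭ ((¬' α) ∷ Γ) →
         Der L r ((¬' α) ∷ β ∷ Γ) α → Der L r ((¬' α) ∷ α ∷ Γ) β →
         Der L r Δ (¬' β)
  nefR : ∀ {Δ Γ α β} → hasNeF L → Δ ↭ ((¬' α) ∷ Γ) →
         Der L r ((¬' α) ∷ Γ) α → Der L r Δ (¬' β)
  copcR : ∀ {Δ Γ α β} → hasCoPC L → Δ ↭ ((¬' α) ∷ Γ) →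
          Der L r ((¬' α) ∷ β ∷ Γ) α → Der L r Δ (¬' β)
  anR  : ∀ {Γ α} → hasAn L → Der L r (α ∷ Γ) (¬' α) → Der L r Γ (¬' α)

G3 : Logic → Ctx → Fm → Set
G3 L = Der L false

G3φ : Logic → Ctx → Fm → Set
G3φ L = Der L true

module Submission where

-- Every G3^φ_L derivation is already a G3_L derivation: the restriction is
-- a side condition that can simply be forgotten (lemma `relax`).
--
-- Conversely, we show that in G3^φ_L the three left rules (→l), (∧l), (∨l)
-- remain admissible WITHOUT the goal restriction, by induction on the goal:
--   * atom, negation, disjunction: the restricted rule applies directly;
--   * ⊤: the goal is an axiom (⊤);
--   * α ∧ β: the premises are invertible for (∧r), so apply the rule to each
--     conjunct and recombine;
--   * α → β: the premises are invertible for (→r); move α into the side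
--     context (using weakening and exchange) and recurse on β.
-- The invertibility holds because in G3^φ_L no left rule can conclude a
-- conjunction or an implication.  Translating a G3_L derivation rule by rule,
-- using these admissible left rules, yields a G3^φ_L derivation (`restrict`).

open import Defs
open import Data.Product using (_×_; _,_)
open import Data.Bool using (Bool; true)
open import Data.Unit using (tt)
open import Data.List using (_∷_)
open import Data.List.Relation.Binary.Permutation.Propositional
  using (_↭_; prep; swap; trans; refl; ↭-sym)

variable
  L : Logic
  r : Bool

swapFront : ∀ {X A : Fm} {Γ} → (X ∷ A ∷ Γ) ↭ (A ∷ X ∷ Γ)
swapFront {X} {A} = swap X A refl

swapFront₂ : ∀ {X Y A : Fm} {Γ} → (X ∷ Y ∷ A ∷ Γ) ↭ (A ∷ X ∷ Y ∷ Γ)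
swapFront₂ {X} {Y} {A} = trans (prep X (swap Y A refl)) (swap X A refl)

extendPrincipal : ∀ {Δ Γ Γ₀} {A X : Fm} →
                  Δ ↭ (A ∷ Γ) → Γ ↭ (X ∷ Γ₀) → Δ ↭ (X ∷ A ∷ Γ₀)
extendPrincipal {A = A} {X} Δ≈ Γ≈ = trans Δ≈ (trans (prep A Γ≈) (swapFront {A}))

weaken : ∀ {Γ Δ A φ} → Der L r Γ φ → Δ ↭ (A ∷ Γ) → Der L r Δ φ
weaken (ax p q)          w = ax p (extendPrincipal w q)
weaken topR              w = topR
weaken (impR d)          w = impR (weaken d (trans (prep _ w) swapFront))
weaken (impL q ok d e)   w = impL (extendPrincipal w q) ok (weaken d swapFront) (weaken e swapFront)
weaken (andR d e)        w = andR (weaken d w) (weaken e w)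
weaken (andL q ok d)     w = andL (extendPrincipal w q) ok (weaken d swapFront₂)
weaken (orR₁ d)          w = orR₁ (weaken d w)
weaken (orR₂ d)          w = orR₂ (weaken d w)
weaken (orL q ok d e)    w = orL (extendPrincipal w q) ok (weaken d swapFront) (weaken e swapFront)
weaken (nR h q d e)      w = nR h (extendPrincipal w q) (weaken d swapFront₂) (weaken e swapFront₂)
weaken (nefR h q d)      w = nefR h (extendPrincipal w q) (weaken d swapFront)
weaken (copcR h q d)     w = copcR h (extendPrincipal w q) (weaken d swapFront₂)
weaken (anR h d)         w = anR h (weaken d (trans (prep _ w) swapFront))

-- Exchange: derivability is invariant under permuting the context, since
-- every rule's conclusion context is only fixed up to permutation.
permute : ∀ {Γ Γ' φ} → Der L r Γ φ → Γ ↭ Γ' → Der L r Γ' φ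
permute (ax p q)         w = ax p (trans (↭-sym w) q)
permute topR             w = topR
permute (impR d)         w = impR (permute d (prep _ w))
permute (impL q ok d e)  w = impL (trans (↭-sym w) q) ok d e
permute (andR d e)       w = andR (permute d w) (permute e w)
permute (andL q ok d)    w = andL (trans (↭-sym w) q) ok d
permute (orR₁ d)         w = orR₁ (permute d w)
permute (orR₂ d)         w = orR₂ (permute d w)
permute (orL q ok d e)   w = orL (trans (↭-sym w) q) ok d e
permute (nR h q d e)     w = nR h (trans (↭-sym w) q) d e
permute (nefR h q d)     w = nefR h (trans (↭-sym w) q) d
permute (copcR h q d)    w = copcR h (trans (↭-sym w) q) d
permute (anR h d)        w = anR h (permute d (prep _ w))

-- Inversion in G3^φ_L: a conjunction or implication goal can only be
-- derived by its right rule, because left rules require an atomic,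
-- negated or disjunctive goal.

∧-inversion : ∀ {Γ A B} → Der L true Γ (A ∧' B) → Der L true Γ A × Der L true Γ B
∧-inversion (andR d e)      = d , e
∧-inversion (impL _ () _ _)
∧-inversion (andL _ () _)
∧-inversion (orL _ () _ _)

⇒-inversion : ∀ {Γ A B} → Der L true Γ (A ⇒ B) → Der L true (A ∷ Γ) B
⇒-inversion (impR d)        = d
⇒-inversion (impL _ () _ _)
⇒-inversion (andL _ () _)
⇒-inversion (orL _ () _ _)

-- In the implication case the antecedent A joins the side
-- context, so the principal formula's permutation is extended by A.

impL-admissible : ∀ {Δ Γ α β φ} → Δ ↭ ((α ⇒ β) ∷ Γ) →
                  Der L true ((α ⇒ β) ∷ Γ) α → Der L true (β ∷ Γ) φ → Der L true Δ φ
impL-admissible {φ = var n}  q d e = impL q (at n) d e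
impL-admissible {φ = top}    q d e = topR
impL-admissible {φ = A ∧' B} q d e with ∧-inversion e
... | e₁ , e₂ = andR (impL-admissible q d e₁) (impL-admissible q d e₂)
impL-admissible {φ = A ∨' B} q d e = impL q (disj A B) d e
impL-admissible {φ = A ⇒ B}  q d e =
  impR (impL-admissible (trans (prep A q) swapFront)
                        (weaken d swapFront) (permute (⇒-inversion e) swapFront))
impL-admissible {φ = ¬' A}   q d e = impL q (neg A) d e

andL-admissible : ∀ {Δ Γ α β φ} → Δ ↭ ((α ∧' β) ∷ Γ) →
                  Der L true (α ∷ β ∷ Γ) φ → Der L true Δ φ
andL-admissible {φ = var n}  q d = andL q (at n) d
andL-admissible {φ = top}    q d = topR
andL-admissible {φ = A ∧' B} q d with ∧-inversion d
... | d₁ , d₂ = andR (andL-admissible q d₁) (andL-admissible q d₂)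
andL-admissible {φ = A ∨' B} q d = andL q (disj A B) d
andL-admissible {φ = A ⇒ B}  q d =
  impR (andL-admissible (trans (prep A q) swapFront) (permute (⇒-inversion d) (↭-sym swapFront₂)))
andL-admissible {φ = ¬' A}   q d = andL q (neg A) d

orL-admissible : ∀ {Δ Γ α β φ} → Δ ↭ ((α ∨' β) ∷ Γ) →
                 Der L true (α ∷ Γ) φ → Der L true (β ∷ Γ) φ → Der L true Δ φ
orL-admissible {φ = var n}  q d e = orL q (at n) d e
orL-admissible {φ = top}    q d e = topR
orL-admissible {φ = A ∧' B} q d e with ∧-inversion d | ∧-inversion e
... | d₁ , d₂ | e₁ , e₂ = andR (orL-admissible q d₁ e₁) (orL-admissible q d₂ e₂)
orL-admissible {φ = A ∨' B} q d e = orL q (disj A B) d e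
orL-admissible {φ = A ⇒ B}  q d e =
  impR (orL-admissible (trans (prep A q) swapFront)
                       (permute (⇒-inversion d) swapFront) (permute (⇒-inversion e) swapFront))
orL-admissible {φ = ¬' A}   q d e = orL q (neg A) d e

restrict : ∀ {Γ φ} → G3 L Γ φ → G3φ L Γ φ
restrict (ax p q)        = ax p q
restrict topR            = topR
restrict (impR d)        = impR (restrict d)
restrict (impL q _ d e)  = impL-admissible q (restrict d) (restrict e)
restrict (andR d e)      = andR (restrict d) (restrict e)
restrict (andL q _ d)    = andL-admissible q (restrict d)
restrict (orR₁ d)        = orR₁ (restrict d)
restrict (orR₂ d)        = orR₂ (restrict d)
restrict (orL q _ d e)   = orL-admissible q (restrict d) (restrict e)
restrict (nR h q d e)    = nR h q (restrict d) (restrict e)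
restrict (nefR h q d)    = nefR h q (restrict d)
restrict (copcR h q d)   = copcR h q (restrict d)
restrict (anR h d)       = anR h (restrict d)

relax : ∀ {Γ φ} → Der L r Γ φ → G3 L Γ φ
relax (ax p q)           = ax p q
relax topR               = topR
relax (impR d)           = impR (relax d)
relax (impL q _ d e)     = impL q tt (relax d) (relax e)
relax (andR d e)         = andR (relax d) (relax e)
relax (andL q _ d)       = andL q tt (relax d)
relax (orR₁ d)           = orR₁ (relax d)
relax (orR₂ d)           = orR₂ (relax d)
relax (orL q _ d e)      = orL q tt (relax d) (relax e)
relax (nR h q d e)       = nR h q (relax d) (relax e)
relax (nefR h q d)       = nefR h q (relax d)
relax (copcR h q d)      = copcR h q (relax d)
relax (anR h d)          = anR h (relax d)

lemma5p2 : (L : Logic) (Γ : Ctx) (φ : Fm) → (G3 L Γ φ → G3φ L Γ φ) × (G3φ L Γ φ → G3 L Γ φ)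
lemma5p2 L Γ φ = restrict , relax
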